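{- Let $\mathfrak{M}=(W,R,V)$ and $\mathfrak{N}=(W',R',V')$ be relational models, $Z\subseteq W\times W'$ a $\#$-bisimulation between them, and $s\in W$, $t\in W'$ with $sZt$. Then for every formula $\varphi$ of $\mathcal{L}^{\mathsf{ml}}_\#$, $\mathfrak{M},s\models\varphi$ iff $\mathfrak{N},t\models\varphi$.
   Context: $\mathcal{L}^{\mathsf{ml}}_\#$ is given by $\varphi::=p\mid\neg\varphi\mid\varphi\wedge\psi\mid\#\varphi\succsim\#\psi$ ($p$ a proposition letter). In a model $\mathfrak{M}=(W,R,V)$ with $R_s=\{u:Rsu\}$, $\mathfrak{M},s\models\#\varphi\succsim\#\psi$ iff $|R_s\cap[\![\varphi]\!]|\ge|R_s\cap[\![\psi]\!]|$, where $[\![\varphi]\!]$ is the set of points satisfying $\varphi$; $p$ and Booleans are as usual. A modal bisimulation is $Z\subseteq W\times W'$ such that $Z$-related points satisfy the same proposition letters, and whenever $xZy$: for every $x'\in R_x$ there is $y'\in R'_y$ with $x'Zy'$, and for every $y'\in R'_y$ there is $x'\in R_x$ with $x'Zy'$. For points $x,y$ of $\mathfrak{M}$ let $x\sim_Z y$ iff $xZz$ and $yZz$ for some $z\in W'$; for points $u,v$ of $\mathfrak{N}$ let $u\sim_Z v$ iff $xZu$ and $xZv$ for some $x\in W$. For $X\subseteq W$, $Z[X]=\{y\in W':xZy\text{ for some }x\in X\}$, and for $Y\subseteq W'$, $Z^{ -1}[Y]=\{x\in W: xZy\text{ for some }y\in Y\}$. $Z$ is a $\#$-bisimulation if it is a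 modal bisimulation and, whenever $sZt$: (a) for all $X,Y\subseteq R_s$ that are closed under $\sim_Z$ within $R_s$ (if $x\in X$, $x'\in R_s$, $x\sim_Z x'$ then $x'\in X$; likewise for $Y$) with $|X|\ge|Y|$, we have $|Z[X]\cap R'_t|\ge|Z[Y]\cap R'_t|$; and (b) for all $X,Y\subseteq R'_t$ closed under $\sim_Z$ within $R'_t$ with $|X|\ge|Y|$, we have $|Z^{ -1}[X]\cap R_s|\ge|Z^{ -1}[Y]\cap R_s|$. -}

module Defs where

open import Data.Nat using (ℕ)
open import Data.Product using (Σ; _×_; _,_; proj₁; proj₂)
open import Data.Empty using (⊥)
open import Relation.Nullary using (¬_)
open import Relation.Binary.PropositionalEquality using (_≡_)
open import Function.Bundles using (_⇔_)

data Form : Set where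
  var  : ℕ → Form
  ¬'_  : Form → Form
  _∧'_ : Form → Form → Form
  #_≿#_ : Form → Form → Form

record Model : Set₁ where
  field
    W : Set
    R : W → W → Set
    V : ℕ → W → Set
open Model public

Subset : Set → Set₁
Subset A = A → Set

_∩_ : {A : Set} → Subset A → Subset A → Subset A
(P ∩ Q) a = P a × Q a

-- Cardinal comparison |P| ≥ |Q|: there is an injection from the set Q into
-- the set P (injectivity judged on the underlying points).
_≥ᶜ_ : {A : Set} → Subset A → Subset A → Set
_≥ᶜ_ {A} P Q =
  Σ (Σ A Q → Σ A P) λ f →
    ∀ a b → proj₁ (f a) ≡ proj₁ (f b) → proj₁ a ≡ proj₁ b

Succ : (M : Model) → W M → Subset (W M)
Succ M s = R M s

mutual
  _,_⊨_ : (M : Model) → W M → Form → Set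
  M , s ⊨ var p = V M p s
  M , s ⊨ (¬' φ) = ¬ (M , s ⊨ φ)
  M , s ⊨ (φ ∧' ψ) = (M , s ⊨ φ) × (M , s ⊨ ψ)
  M , s ⊨ (# φ ≿# ψ) = (Succ M s ∩ ⟦ M ⟧ φ) ≥ᶜ (Succ M s ∩ ⟦ M ⟧ ψ)

  ⟦_⟧ : (M : Model) → Form → Subset (W M)
  ⟦ M ⟧ φ w = M , w ⊨ φ

image : {A B : Set} → (A → B → Set) → Subset A → Subset B
image {A} Z X y = Σ A λ x → X x × Z x y

preimage : {A B : Set} → (A → B → Set) → Subset B → Subset A
preimage {B = B} Z Y x = Σ B λ y → Y y × Z x y

_∼ˡ[_]_ : {A B : Set} → A → (A → B → Set) → A → Set
_∼ˡ[_]_ {B = B} x Z y = Σ B λ z → Z x z × Z y z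

_∼ʳ[_]_ : {A B : Set} → B → (A → B → Set) → B → Set
_∼ʳ[_]_ {A = A} u Z v = Σ A λ x → Z x u × Z x v

ClosedWithin : {A : Set} → (A → A → Set) → Subset A → Subset A → Set
ClosedWithin {A} _∼_ S X =
  (∀ x → X x → S x) ×
  (∀ x x' → X x → S x' → x ∼ x' → X x')

record IsBisim (M N : Model) (Z : W M → W N → Set) : Set where
  field
    atoms : ∀ x y → Z x y → ∀ p → V M p x ⇔ V N p y
    forth : ∀ x y → Z x y → ∀ x' → R M x x' → Σ (W N) λ y' → R N y y' × Z x' y'
    back  : ∀ x y → Z x y → ∀ y' → R N y y' → Σ (W M) λ x' → R M x x' × Z x' y'

record Is#Bisim (M N : Model) (Z : W M → W N → Set) : Set₁ where
  field
    bisim : IsBisim M N Z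
    cardForth : ∀ s t → Z s t → (X Y : Subset (W M)) →
      ClosedWithin (λ x y → x ∼ˡ[ Z ] y) (Succ M s) X →
      ClosedWithin (λ x y → x ∼ˡ[ Z ] y) (Succ M s) Y →
      X ≥ᶜ Y →
      (image Z X ∩ Succ N t) ≥ᶜ (image Z Y ∩ Succ N t)
    cardBack : ∀ s t → Z s t → (X Y : Subset (W N)) →
      ClosedWithin (λ u v → u ∼ʳ[ Z ] v) (Succ N t) X →
      ClosedWithin (λ u v → u ∼ʳ[ Z ] v) (Succ N t) Y →
      X ≥ᶜ Y →
      (preimage Z X ∩ Succ M s) ≥ᶜ (preimage Z Y ∩ Succ M s)

{-# OPTIONS --safe #-}
module Submission where

-- The truth sets of φ in 𝔐 and 𝔑 agree along Z, by induction on φ. For #φ ≿ #ψ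
-- at s Z t, the parts of R_s satisfying φ and ψ are then closed under ∼_Z, and
-- by the back (forth) clause their Z-images (Z-preimages) are exactly the parts
-- of R'_t (R_s) satisfying φ and ψ; so the cardinality clauses carry the
-- comparison across in both directions.

open import Data.Product using (_,_; proj₁)
open import Data.Product.Function.NonDependent.Propositional using (_×-⇔_)
open import Function.Bundles using (_⇔_; mk⇔; Equivalence)
open import Function.Related.TypeIsomorphisms using (¬-cong-⇔)
open import Relation.Unary using (_⊆_; _≐_)

open import Defs

open Equivalence

≥ᶜ-mono : {A : Set} {P P′ Q Q′ : Subset A} → P ⊆ P′ → Q′ ⊆ Q → P ≥ᶜ Q → P′ ≥ᶜ Q′
≥ᶜ-mono P⊆P′ Q′⊆Q (f , f-inj) =
  (λ (a , q) → let (b , p) = f (a , Q′⊆Q q) in b , P⊆P′ p) ,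
  λ (a , qa) (b , qb) → f-inj (a , Q′⊆Q qa) (b , Q′⊆Q qb)

≥ᶜ-resp-≐ : {A : Set} {P P′ Q Q′ : Subset A} → P ≐ P′ → Q ≐ Q′ → P ≥ᶜ Q → P′ ≥ᶜ Q′
≥ᶜ-resp-≐ (P⊆P′ , _) (_ , Q′⊆Q) = ≥ᶜ-mono P⊆P′ Q′⊆Q

module _ {M N : Model} {Z : W M → W N → Set} where

  Invariant : Subset (W M) → Subset (W N) → Set
  Invariant P Q = ∀ {x y} → Z x y → P x ⇔ Q y

  ∩-closedˡ : ∀ {P Q} → Invariant P Q → ∀ s →
    ClosedWithin (λ x y → x ∼ˡ[ Z ] y) (Succ M s) (Succ M s ∩ P)
  ∩-closedˡ P≈Q s =
    (λ _ → proj₁) ,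
    λ _ _ (_ , Px) sx′ (_ , zx , zx′) → sx′ , from (P≈Q zx′) (to (P≈Q zx) Px)

  ∩-closedʳ : ∀ {P Q} → Invariant P Q → ∀ t →
    ClosedWithin (λ u v → u ∼ʳ[ Z ] v) (Succ N t) (Succ N t ∩ Q)
  ∩-closedʳ P≈Q t =
    (λ _ → proj₁) ,
    λ _ _ (_ , Qu) tu′ (_ , zu , zu′) → tu′ , to (P≈Q zu′) (from (P≈Q zu) Qu)

  module _ (bisim : IsBisim M N Z) {s t} (zst : Z s t) {P Q} (P≈Q : Invariant P Q) where
    open IsBisim bisim

    image-∩-Succ : (image Z (Succ M s ∩ P) ∩ Succ N t) ≐ (Succ N t ∩ Q)
    image-∩-Succ =
      (λ ((_ , (_ , Px) , zxy) , ty) → ty , to (P≈Q zxy) Px) ,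
      λ {y} (ty , Qy) → let (x , sx , zxy) = back s t zst y ty in
        (x , (sx , from (P≈Q zxy) Qy) , zxy) , ty

    preimage-∩-Succ : (preimage Z (Succ N t ∩ Q) ∩ Succ M s) ≐ (Succ M s ∩ P)
    preimage-∩-Succ =
      (λ ((_ , (_ , Qy) , zxy) , sx) → sx , from (P≈Q zxy) Qy) ,
      λ {x} (sx , Px) → let (y , ty , zxy) = forth s t zst x sx in
        (y , (ty , to (P≈Q zxy) Px) , zxy) , sx

  ≥ᶜ-Succ-transfer : Is#Bisim M N Z → ∀ {s t} → Z s t →
    ∀ {P P′ Q Q′} → Invariant P P′ → Invariant Q Q′ →
    (Succ M s ∩ P) ≥ᶜ (Succ M s ∩ Q) ⇔ (Succ N t ∩ P′) ≥ᶜ (Succ N t ∩ Q′)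
  ≥ᶜ-Succ-transfer #bisim {s} {t} zst P≈P′ Q≈Q′ = mk⇔
    (λ sP≥sQ → ≥ᶜ-resp-≐ (image-∩-Succ bisim zst P≈P′) (image-∩-Succ bisim zst Q≈Q′)
      (cardForth s t zst _ _ (∩-closedˡ P≈P′ s) (∩-closedˡ Q≈Q′ s) sP≥sQ))
    (λ tP′≥tQ′ → ≥ᶜ-resp-≐ (preimage-∩-Succ bisim zst P≈P′) (preimage-∩-Succ bisim zst Q≈Q′)
      (cardBack s t zst _ _ (∩-closedʳ P≈P′ t) (∩-closedʳ Q≈Q′ t) tP′≥tQ′))
    where open Is#Bisim #bisim

  ⟦⟧-invariant : Is#Bisim M N Z → ∀ φ → Invariant (⟦ M ⟧ φ) (⟦ N ⟧ φ)
  ⟦⟧-invariant #bisim (var p) {x} {y} zxy = IsBisim.atoms (Is#Bisim.bisim #bisim) x y zxy p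
  ⟦⟧-invariant #bisim (¬' φ) zxy = ¬-cong-⇔ (⟦⟧-invariant #bisim φ zxy)
  ⟦⟧-invariant #bisim (φ ∧' ψ) zxy = ⟦⟧-invariant #bisim φ zxy ×-⇔ ⟦⟧-invariant #bisim ψ zxy
  ⟦⟧-invariant #bisim (# φ ≿# ψ) zxy =
    ≥ᶜ-Succ-transfer #bisim zxy (⟦⟧-invariant #bisim φ) (⟦⟧-invariant #bisim ψ)

proposition7p9 : (M N : Model) (Z : W M → W N → Set) → Is#Bisim M N Z →
    (s : W M) (t : W N) → Z s t → (φ : Form) → (M , s ⊨ φ) ⇔ (N , t ⊨ φ)
proposition7p9 M N Z #bisim s t zst φ = ⟦⟧-invariant #bisim φ zst
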